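{- Let $(\Sigma,<)$ be a finite totally ordered alphabet, let $w\in\Sigma^+$, let $\mathrm{CFL}_{in}(w)=(\ell_1,\ldots,\ell_h)$ and let $(\mathcal{C}_1,\ldots,\mathcal{C}_s)$ be the decomposition of $\mathrm{CFL}_{in}(w)$ into its non-increasing maximal chains for the prefix order. Let $w_1,\ldots,w_s$ be words such that $\mathrm{CFL}_{in}(w_j)=\mathcal{C}_j$ for $1\le j\le s$. Then $$\mathrm{ICFL}(w)=(\mathrm{ICFL}(w_1),\ldots,\mathrm{ICFL}(w_s)),$$ i.e. $\mathrm{ICFL}(w)$ is the concatenation of the sequences $\mathrm{ICFL}(w_1),\ldots,\mathrm{ICFL}(w_s)$.
   Context: Words are elements of $\Sigma^*$; $1$ is the empty word, $\Sigma^+=\Sigma^*\setminus\{1\}$. Lexicographic order $\prec$: $x\prec y$ if $x$ is a proper prefix of $y$, or $x=ras$, $y=rbt$ with $a,b\in\Sigma$, $a<b$. For nonempty $x,y$, $x\ll y$ means $x\prec y$ and $x$ not a proper prefix of $y$. $x\le_p y$ means $x$ is a prefix of $y$; $x\ge_p y$ means $y$ is a prefix of $x$. The inverse order $<_{in}$ on $\Sigma$: $b<_{in}a\iff a<b$; $\prec_{in}$ is the lexicographic order induced by $<_{in}$. An anti-Lyndon word is a nonempty primitive word strictly smaller for $\prec_{in}$ than all its other conjugates. $\mathrm{CFL}_{in}(w)$ is the unique sequence $(\ell_1,\ldots,\ell_h)$ of anti-Lyndon words with $w=\ell_1\cdots\ell_h$ and $\ell_1\succeq_{in}\cdots\succeq_{in}\ell_h$.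 Non-increasing maximal chain for the prefix order (PMC) in $\mathrm{CFL}_{in}(w)=(\ell_1,\ldots,\ell_h)$: a block $\ell_r,\ell_{r+1},\ldots,\ell_t$ of consecutive factors ($1\le r\le t\le h$) with $\ell_r\ge_p\ell_{r+1}\ge_p\cdots\ge_p\ell_t$, such that if $r>1$ then $\ell_r$ is not a prefix of $\ell_{r-1}$ and if $t<h$ then $\ell_{t+1}$ is not a prefix of $\ell_t$. The decomposition of $\mathrm{CFL}_{in}(w)$ into its PMCs is the sequence $(\mathcal{C}_1,\ldots,\mathcal{C}_s)$ of PMCs, each consecutive to the next, whose concatenation is $\mathrm{CFL}_{in}(w)$. An inverse Lyndon word is a $w\in\Sigma^+$ with $s\prec w$ for every nonempty proper suffix $s$ of $w$. For $w=pv$ with $p$ an inverse Lyndon nonempty proper prefix, a bounded right extension of $p$ is a nonempty prefix $\overline p$ of $v$ such that $\overline p$ is inverse Lyndon, $pz'$ is inverse Lyndon for every proper nonempty prefix $z'$ of $\overline p$, $p\overline p$ is not inverse Lyndon, and $p\ll\overline p$. If $w$ is not inverse Lyndon there is exactly one such pair $(p,\overline p)$, the canonical pair of $w$. $\mathrm{ICFL}(w)$: if $w$ is inverse Lyndon, $\mathrm{ICFL}(w)=(w)$; otherwise, with canonical pair $(p,\overline p)$, $w=pv$, $\overline p=rb$ ($b\in\Sigma$), $\mathrm{ICFL}(v)=(m'_1,\ldots,m'_{k'})$: $\mathrm{ICFL}(w)=(p,m'_1,\ldots,m'_{k'})$ if $\overline p\le_p m'_1$, and $\mathrm{ICFL}(w)=(pm'_1,m'_2,\ldots,m'_{k'})$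 if $m'_1\le_p r$ (exactly one case occurs). -}

module Defs where

open import Data.Nat using (ℕ)
open import Data.Fin using (Fin) renaming (_<_ to _<ᶠ_)
open import Data.List using (List; []; _∷_; _++_; concat; head; last)
open import Data.List.Relation.Unary.All using (All)
open import Data.List.Relation.Unary.Linked using (Linked)
open import Data.Maybe using (just)
open import Data.Product using (Σ; ∃; _×_)
open import Data.Sum using (_⊎_)
open import Relation.Binary.PropositionalEquality using (_≡_; _≢_)
open import Relation.Nullary using (¬_)

-- The finite totally ordered alphabet (Σ,<) is taken to be Fin n with its
-- usual order (every finite total order is order-isomorphic to one of these).
Word : ℕ → Set
Word n = List (Fin n)

module _ {A : Set} where
  Prefix : List A → List A → Set
  Prefix x y = ∃ λ z → x ++ z ≡ y

  ProperPrefix : List A → List A → Set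
  ProperPrefix x y = Prefix x y × x ≢ y

  Lex : (A → A → Set) → List A → List A → Set
  Lex R x y = ProperPrefix x y
    ⊎ (Σ (List A) λ r → Σ A λ a → Σ (List A) λ s → Σ A λ b → Σ (List A) λ t →
         (x ≡ r ++ (a ∷ s)) × (y ≡ r ++ (b ∷ t)) × R a b)

module _ {n : ℕ} where
  _≺_ : Word n → Word n → Set
  _≺_ = Lex _<ᶠ_

  _<in_ : Fin n → Fin n → Set
  b <in a = a <ᶠ b

  _≺in_ : Word n → Word n → Set
  _≺in_ = Lex _<in_

  _⪯in_ : Word n → Word n → Set
  x ⪯in y = x ≺in y ⊎ x ≡ y

  _≪_ : Word n → Word n → Set
  x ≪ y = x ≺ y × ¬ ProperPrefix x y

  Primitive : Word n → Set
  Primitive w = ∀ (u : Word n) (k : ℕ) → w ≡ concat (Data.List.replicate k u) → k ≡ 1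

  AntiLyndon : Word n → Set
  AntiLyndon w = (w ≢ []) × Primitive w ×
    (∀ (u v : Word n) → w ≡ u ++ v → v ++ u ≢ w → w ≺in (v ++ u))

  IsCFLin : Word n → List (Word n) → Set
  IsCFLin w ls = All AntiLyndon ls × (concat ls ≡ w) × Linked (λ a b → b ⪯in a) ls

  PMCBoundary : List (Word n) → List (Word n) → Set
  PMCBoundary C D = ∀ x y → last C ≡ just x → head D ≡ just y → ¬ Prefix y x

  IsPMCDecomp : List (Word n) → List (List (Word n)) → Set
  IsPMCDecomp ls Cs = (concat Cs ≡ ls)
    × All (λ C → (C ≢ []) × Linked (λ a b → Prefix b a) C) Cs
    × Linked PMCBoundary Cs

  InvLyndon : Word n → Set
  InvLyndon w = (w ≢ []) ×
    (∀ (u s : Word n) → w ≡ u ++ s → u ≢ [] → s ≢ [] → s ≺ w)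

  BoundedRightExt : Word n → Word n → Word n → Set
  BoundedRightExt p v pbar = (pbar ≢ []) × Prefix pbar v × InvLyndon pbar
    × (∀ z' → ProperPrefix z' pbar → z' ≢ [] → InvLyndon (p ++ z'))
    × ¬ InvLyndon (p ++ pbar)
    × p ≪ pbar

  CanonicalPair : Word n → Word n → Word n → Word n → Set
  CanonicalPair w p v pbar = (w ≡ p ++ v) × (p ≢ []) × (v ≢ [])
    × InvLyndon p × BoundedRightExt p v pbar

  data IsICFL : Word n → List (Word n) → Set where
    icfl-inv : ∀ {w} → InvLyndon w → IsICFL w (w ∷ [])
    icfl-1 : ∀ {w p v pbar m ms} → ¬ InvLyndon w → CanonicalPair w p v pbar →
      IsICFL v (m ∷ ms) → Prefix pbar m → IsICFL w (p ∷ m ∷ ms)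
    icfl-2 : ∀ {w p v pbar r b m ms} → ¬ InvLyndon w → CanonicalPair w p v pbar →
      IsICFL v (m ∷ ms) → pbar ≡ r ++ (b ∷ []) → Prefix m r →
      IsICFL w ((p ++ m) ∷ ms)

-- Let g be the first factor of the PMC 𝒞ⱼ₊₁ and t the last factor of 𝒞ⱼ. Since g ⪯in t
-- and g is not a prefix of t, t ≪ g; every factor of 𝒞ⱼ extends t, and anti-Lyndon
-- words are unbordered, so every nonempty suffix of wⱼ is ≪ g. On the right, g is a
-- prefix of y = wⱼ₊₁ ⋯ wₛ and, being anti-Lyndon, also of the first factor of ICFL(y).
-- Under these conditions the recursion computing ICFL(wⱼ y) from canonical pairs runs
-- exactly as for ICFL(wⱼ) and then hands over to ICFL(y): writing r a ⊑ x and r b ⊑ g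
-- with a < b for a suffix x of wⱼ, the word x r b is not inverse Lyndon, which traps
-- the canonical pair of x y between x and x r b. Canonical pairs are unique, so ICFL is
-- a function, which gives the uniqueness part.

module Submission where

open import Defs
open import Data.Nat using (ℕ)
open import Data.List using (List; []; concat)
open import Data.List.Relation.Binary.Pointwise using (Pointwise)
open import Data.Product using (Σ; _×_)
open import Relation.Binary.PropositionalEquality using (_≡_; _≢_)

open import Level using (0ℓ)
open import Function using (_∘_; flip)
open import Data.Empty using (⊥; ⊥-elim)
open import Data.Product using (∃; ∃₂; _,_; proj₁; proj₂; map₁)
open import Data.Sum using (_⊎_; inj₁; inj₂)
open import Data.Maybe.Base using (just)
open import Data.Nat.Base using (zero; suc; _+_; _≤_; _<_; z≤n; s≤s)
import Data.Nat.Properties as ℕ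
open import Data.Nat.Induction using (<-wellFounded)
open import Induction.WellFounded using (Acc; acc)
open import Data.Fin.Base using () renaming (_<_ to _<ᶠ_)
import Data.Fin.Properties as Fin
open import Data.List.Base
  using (_∷_; _++_; _∷ʳ_; [_]; length; replicate; last; initLast; _∷ʳ′_)
open import Data.List.Properties
  using ( ++-assoc; ++-identityʳ; ++-identityʳ-unique; ++-cancelˡ; ++-cancelʳ; ++-conicalˡ
        ; ++-conicalʳ; ∷-injectiveʳ; concat-++; length-++; length-++-comm; ≡-dec)
open import Data.List.Relation.Unary.All as All using (All; []; _∷_)
open import Data.List.Relation.Unary.Linked as Linked using (Linked; []; [-]; _∷_)
open import Data.List.Relation.Binary.Pointwise using ([]; _∷_; Pointwise-≡⇒≡; ≡⇒Pointwise-≡)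
open import Data.List.Relation.Binary.Prefix.Heterogeneous as Prefixᴴ using ([]; _∷_; _++ᵖ_)
import Data.List.Relation.Binary.Prefix.Heterogeneous.Properties as Prefixₚ
open import Relation.Binary using (Rel; IsStrictTotalOrder; tri<; tri≈; tri>)
open import Relation.Binary.PropositionalEquality
  using (refl; sym; trans; cong; cong₂; subst; subst₂)
open import Relation.Nullary using (¬_; Dec; yes; no; ¬?; contradiction)
open import Relation.Nullary.Decidable using (decidable-stable)
open import Relation.Unary using (Decidable)

open Relation.Binary.PropositionalEquality.≡-Reasoning

module _ {A : Set} where

  infix 4 _⊑_

  _⊑_ : List A → List A → Set
  _⊑_ = Prefixᴴ.Prefix _≡_

  ⊑-refl : ∀ {x} → x ⊑ x
  ⊑-refl = Prefixₚ.fromPointwise (≡⇒Pointwise-≡ refl)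

  ⊑-++ : ∀ x z → x ⊑ x ++ z
  ⊑-++ x z = ⊑-refl ++ᵖ z

  ⊑-trans : ∀ {x y z} → x ⊑ y → y ⊑ z → x ⊑ z
  ⊑-trans = Prefixₚ.trans trans

  ⊑-length : ∀ {x y} → x ⊑ y → length x ≤ length y
  ⊑-length = Prefixₚ.length-mono

  ⊑-++⁺ˡ : ∀ r {x y} → x ⊑ y → r ++ x ⊑ r ++ y
  ⊑-++⁺ˡ r = Prefixₚ.++⁺ (≡⇒Pointwise-≡ {x = r} refl)

  ⊑-++⁻ˡ : ∀ r {x y} → r ++ x ⊑ r ++ y → x ⊑ y
  ⊑-++⁻ˡ r = Prefixₚ.++⁻ {as = r} refl

  ⊑-longer⇒≡ : ∀ {x y} → x ⊑ y → length y ≤ length x → x ≡ y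
  ⊑-longer⇒≡ x⊑y |y|≤|x| =
    Pointwise-≡⇒≡ (Prefixₚ.toPointwise (ℕ.≤-antisym (⊑-length x⊑y) |y|≤|x|) x⊑y)

  ⊑-total : ∀ {x y z} → x ⊑ z → y ⊑ z → x ⊑ y ⊎ y ⊑ x
  ⊑-total []           _            = inj₁ []
  ⊑-total (_ ∷ _)      []           = inj₂ []
  ⊑-total (refl ∷ x⊑z) (refl ∷ y⊑z) with ⊑-total x⊑z y⊑z
  ... | inj₁ x⊑y = inj₁ (refl ∷ x⊑y)
  ... | inj₂ y⊑x = inj₂ (refl ∷ y⊑x)

  ⊑-by-length : ∀ {x y z} → x ⊑ z → y ⊑ z → length x ≤ length y → x ⊑ y
  ⊑-by-length x⊑z y⊑z |x|≤|y| with ⊑-total x⊑z y⊑z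
  ... | inj₁ x⊑y = x⊑y
  ... | inj₂ y⊑x = subst (_⊑ _) (⊑-longer⇒≡ y⊑x |x|≤|y|) ⊑-refl

  ⊑-∷ʳ : ∀ {x} y c → x ⊑ y ∷ʳ c → x ⊑ y ⊎ x ≡ y ∷ʳ c
  ⊑-∷ʳ []      c []                = inj₁ []
  ⊑-∷ʳ []      c (refl ∷ [])       = inj₂ refl
  ⊑-∷ʳ (b ∷ y) c []                = inj₁ []
  ⊑-∷ʳ (b ∷ y) c (refl ∷ x⊑y∷ʳc) with ⊑-∷ʳ y c x⊑y∷ʳc
  ... | inj₁ x⊑y = inj₁ (refl ∷ x⊑y)
  ... | inj₂ x≡y∷ʳc = inj₂ (cong (b ∷_) x≡y∷ʳc)

  ⊑⇒Prefix : ∀ {x y} → x ⊑ y → Prefix x y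
  ⊑⇒Prefix {y = y} [] = y , refl
  ⊑⇒Prefix (refl ∷ x⊑y) with z , refl ← ⊑⇒Prefix x⊑y = z , refl

  Prefix⇒⊑ : ∀ {x y} → Prefix x y → x ⊑ y
  Prefix⇒⊑ {x} (z , refl) = ⊑-++ x z

  ++-≢[]ˡ : ∀ {x : List A} y → x ≢ [] → x ++ y ≢ []
  ++-≢[]ˡ {x} y x≢[] = x≢[] ∘ ++-conicalˡ x y

  ≢[]⇒≢++ : ∀ x {y : List A} → y ≢ [] → x ≢ x ++ y
  ≢[]⇒≢++ x y≢[] = y≢[] ∘ ++-identityʳ-unique x

  ≢++⇒≢[] : ∀ x {y : List A} → x ≢ x ++ y → y ≢ []
  ≢++⇒≢[] x x≢xy refl = x≢xy (sym (++-identityʳ x))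

  ++-≢[]ʳ : ∀ x {y : List A} → y ≢ [] → x ++ y ≢ []
  ++-≢[]ʳ []      y≢[] = y≢[]
  ++-≢[]ʳ (_ ∷ _) _    ()

  ≢[]⇒length>0 : ∀ {x : List A} → x ≢ [] → 0 < length x
  ≢[]⇒length>0 {[]}    []≢[] = contradiction refl []≢[]
  ≢[]⇒length>0 {_ ∷ _} _     = s≤s z≤n

  length-suffix< : ∀ u s → u ≢ [] → length s < length (u ++ s)
  length-suffix< u s u≢[] = subst (length s <_) (sym (length-++ u))
    (ℕ.m<n+m (length s) (≢[]⇒length>0 u≢[]))

  length-prefix< : ∀ p v → v ≢ [] → length p < length (p ++ v)
  length-prefix< p v v≢[] = subst (length p <_) (sym (length-++ p))
    (ℕ.m<m+n (length p) (≢[]⇒length>0 v≢[]))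

  Linked-++⁻ʳ : ∀ {R : Rel A 0ℓ} xs {ys} → Linked R (xs ++ ys) → Linked R ys
  Linked-++⁻ʳ []       linked = linked
  Linked-++⁻ʳ (_ ∷ xs) linked = Linked-++⁻ʳ xs (Linked.tail linked)

  Suffixes⁺ : (List A → Set) → List A → Set
  Suffixes⁺ P w = ∀ u s → w ≡ u ++ s → s ≢ [] → P s

  ProperSuffixes : (List A → Set) → List A → Set
  ProperSuffixes P w = ∀ u s → w ≡ u ++ s → u ≢ [] → s ≢ [] → P s

  Suffixes⁺-suffix : ∀ {P : List A → Set} {w p v} → w ≡ p ++ v → Suffixes⁺ P w → Suffixes⁺ P v
  Suffixes⁺-suffix {p = p} w≡pv all u s v≡us =
    all (p ++ u) s (trans w≡pv (trans (cong (p ++_) v≡us) (sym (++-assoc p u s))))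

  ShortestSuffix : (List A → Set) → List A → List A → Set
  ShortestSuffix P w s = (∃ λ u → w ≡ u ++ s) × s ≢ [] × P s × ProperSuffixes (¬_ ∘ P) s

  shortest-suffix : ∀ {P} → Decidable P → ∀ w → ∃ (ShortestSuffix P w) ⊎ Suffixes⁺ (¬_ ∘ P) w
  shortest-suffix P? [] = inj₂ λ u s []≡us s≢[] _ → s≢[] (++-conicalʳ u s (sym []≡us))
  shortest-suffix {P} P? (a ∷ w) with shortest-suffix P? w
  ... | inj₁ (s , (u , w≡us) , shortest) = inj₁ (s , (a ∷ u , cong (a ∷_) w≡us) , shortest)
  ... | inj₂ none with P? (a ∷ w)
  ...   | yes Paw = inj₁ (a ∷ w , ([] , refl) , (λ ()) , Paw , minimal)
    where
    minimal : ProperSuffixes (¬_ ∘ P) (a ∷ w)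
    minimal []      _ _    []≢[] _    = contradiction refl []≢[]
    minimal (_ ∷ u) s refl _     s≢[] = none u s refl s≢[]
  ...   | no ¬Paw = inj₂ none′
    where
    none′ : Suffixes⁺ (¬_ ∘ P) (a ∷ w)
    none′ []      _ refl _    = ¬Paw
    none′ (_ ∷ u) s refl s≢[] = none u s refl s≢[]

  ShortestPrefix : (List A → Set) → List A → List A → Set
  ShortestPrefix P w u = u ⊑ w × P u × (∀ v → v ⊑ u → v ≢ u → ¬ P v)

  shortest-prefix : ∀ {P} → Decidable P → ∀ w → P w → ∃ (ShortestPrefix P w)
  shortest-prefix P? w Pw with P? []
  ... | yes P[] = [] , [] , P[] , λ { [] _ []≢[] → contradiction refl []≢[] }
  shortest-prefix P? []      Pw | no ¬P[] = contradiction Pw ¬P[]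
  shortest-prefix {P} P? (a ∷ w) Pw | no ¬P[]
    with u , u⊑w , Pau , minimal ← shortest-prefix {P ∘ (a ∷_)} (P? ∘ (a ∷_)) w Pw =
    a ∷ u , refl ∷ u⊑w , Pau , minimal′
    where
    minimal′ : ∀ v → v ⊑ a ∷ u → v ≢ a ∷ u → ¬ P v
    minimal′ []      _           _      = ¬P[]
    minimal′ (_ ∷ v) (refl ∷ v⊑u) v≢au = minimal v v⊑u (v≢au ∘ cong (a ∷_))

  shortest-prefix-⊑ : ∀ {P w u v} → ShortestPrefix P w u → v ⊑ w → P v → u ⊑ v
  shortest-prefix-⊑ {u = u} {v} (u⊑w , _ , minimal) v⊑w Pv with ⊑-total u⊑w v⊑w
  ... | inj₁ u⊑v = u⊑v
  ... | inj₂ v⊑u with length u ℕ.≤? length v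
  ...   | yes |u|≤|v| = subst (_⊑ v) (⊑-longer⇒≡ v⊑u |u|≤|v|) ⊑-refl
  ...   | no |u|≰|v|  =
    contradiction Pv (minimal v v⊑u (|u|≰|v| ∘ ℕ.≤-reflexive ∘ cong length ∘ sym))

  shortest-prefix-unique : ∀ {P w u u′} → ShortestPrefix P w u → ShortestPrefix P w u′ → u ≡ u′
  shortest-prefix-unique sp@(u⊑w , Pu , _) sp′@(u′⊑w , Pu′ , _) =
    ⊑-longer⇒≡ (shortest-prefix-⊑ sp u′⊑w Pu′) (⊑-length (shortest-prefix-⊑ sp′ u⊑w Pu))

  infixr 8 _^_

  _^_ : List A → ℕ → List A
  u ^ k = concat (replicate k u)

  ^-+ : ∀ u i j → u ^ (i + j) ≡ u ^ i ++ u ^ j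
  ^-+ u zero    j = refl
  ^-+ u (suc i) j = trans (cong (u ++_) (^-+ u i j)) (sym (++-assoc u (u ^ i) (u ^ j)))

  commuting⇒powers : ∀ x y → Acc _<_ (length x + length y) → x ++ y ≡ y ++ x →
                     ∃ λ u → ∃₂ λ i j → x ≡ u ^ i × y ≡ u ^ j
  commuting⇒powers [] y _ _ = y , 0 , 1 , refl , sym (++-identityʳ y)
  commuting⇒powers x [] _ _ = x , 1 , 0 , sym (++-identityʳ x) , refl
  commuting⇒powers x@(_ ∷ _) y@(_ ∷ _) (acc rec) xy≡yx
    with ⊑-total (⊑-++ x y) (subst (y ⊑_) (sym xy≡yx) (⊑-++ y x))
  ... | inj₁ x⊑y with y′ , refl ← ⊑⇒Prefix x⊑y
    with u , i , j , x≡uⁱ , y′≡uʲ ← commuting⇒powers x y′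
           (rec (ℕ.+-monoʳ-< (length x) (length-suffix< x y′ (λ ()))))
           (++-cancelˡ x _ _ (begin
             x ++ x ++ y′   ≡⟨ xy≡yx ⟩
             (x ++ y′) ++ x ≡⟨ ++-assoc x y′ x ⟩
             x ++ y′ ++ x   ∎))
    = u , i , i + j , x≡uⁱ , trans (cong₂ _++_ x≡uⁱ y′≡uʲ) (sym (^-+ u i j))
  ... | inj₂ y⊑x with x′ , refl ← ⊑⇒Prefix y⊑x
    with u , i , j , x′≡uⁱ , y≡uʲ ← commuting⇒powers x′ y
           (rec (ℕ.+-monoˡ-< (length y) (length-suffix< y x′ (λ ()))))
           (++-cancelˡ y _ _ (begin
             y ++ x′ ++ y   ≡⟨ ++-assoc y x′ y ⟨
             (y ++ x′) ++ y ≡⟨ xy≡yx ⟩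
             y ++ y ++ x′   ∎))
    = u , j + i , j , trans (cong₂ _++_ y≡uʲ x′≡uⁱ) (sym (^-+ u j i)) , y≡uʲ

  ++-≡-++ : ∀ (ℓ R u s : List A) → ℓ ++ R ≡ u ++ s →
            (∃₂ λ u′ s′ → ℓ ≡ u′ ++ s′ × s ≡ s′ ++ R × s′ ≢ []) ⊎ (∃ λ u″ → R ≡ u″ ++ s)
  ++-≡-++ []      R u       s R≡us = inj₂ (u , R≡us)
  ++-≡-++ (a ∷ ℓ) R []      s aℓR≡s = inj₁ ([] , a ∷ ℓ , refl , sym aℓR≡s , λ ())
  ++-≡-++ (a ∷ ℓ) R (b ∷ u) s aℓR≡bus with ++-≡-++ ℓ R u s (∷-injectiveʳ aℓR≡bus)
  ... | inj₁ (u′ , s′ , ℓ≡u′s′ , s≡s′R , s′≢[]) =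
    inj₁ (a ∷ u′ , s′ , cong (a ∷_) ℓ≡u′s′ , s≡s′R , s′≢[])
  ... | inj₂ R≡u″s = inj₂ R≡u″s

module LexOrder {A : Set} {_<_ : Rel A 0ℓ} (<-sto : IsStrictTotalOrder _≡_ _<_) where

  open IsStrictTotalOrder <-sto using () renaming
    (irrefl to <-irrefl; asym to <-asym; trans to <-trans; compare to <-cmp)

  -- The inductive form of x ≪ y (see ⊏⇒≪ and ≪⇒⊏).
  infix 4 _⊏_

  data _⊏_ : List A → List A → Set where
    here  : ∀ {a b x y} → a < b → a ∷ x ⊏ b ∷ y
    there : ∀ {a x y} → x ⊏ y → a ∷ x ⊏ a ∷ y

  ⊏-irrefl : ∀ {x} → ¬ x ⊏ x
  ⊏-irrefl (here a<a)  = <-irrefl refl a<a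
  ⊏-irrefl (there x⊏x) = ⊏-irrefl x⊏x

  ⊏-asym : ∀ {x y} → x ⊏ y → ¬ y ⊏ x
  ⊏-asym (here a<b)  (here b<a)  = <-asym a<b b<a
  ⊏-asym (here a<a)  (there _)   = <-irrefl refl a<a
  ⊏-asym (there _)   (here a<a)  = <-irrefl refl a<a
  ⊏-asym (there x⊏y) (there y⊏x) = ⊏-asym x⊏y y⊏x

  ⊏-trans : ∀ {x y z} → x ⊏ y → y ⊏ z → x ⊏ z
  ⊏-trans (here a<b)  (here b<c)  = here (<-trans a<b b<c)
  ⊏-trans (here a<b)  (there _)   = here a<b
  ⊏-trans (there _)   (here b<c)  = here b<c
  ⊏-trans (there x⊏y) (there y⊏z) = there (⊏-trans x⊏y y⊏z)

  ⊏⇒⋢ : ∀ {x y} → x ⊏ y → ¬ x ⊑ y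
  ⊏⇒⋢ (here a<a)  (refl ∷ _)   = <-irrefl refl a<a
  ⊏⇒⋢ (there x⊏y) (refl ∷ x⊑y) = ⊏⇒⋢ x⊏y x⊑y

  ⊏⇒⋣ : ∀ {x y} → x ⊏ y → ¬ y ⊑ x
  ⊏⇒⋣ (here a<a)  (refl ∷ _)   = <-irrefl refl a<a
  ⊏⇒⋣ (there x⊏y) (refl ∷ y⊑x) = ⊏⇒⋣ x⊏y y⊑x

  ⊏⇒⋡ : ∀ {x y} → x ⊏ y → ¬ (y ⊑ x ⊎ y ⊏ x)
  ⊏⇒⋡ x⊏y (inj₁ y⊑x) = ⊏⇒⋣ x⊏y y⊑x
  ⊏⇒⋡ x⊏y (inj₂ y⊏x) = ⊏-asym x⊏y y⊏x

  ⊏-⊑ˡ : ∀ {x x′ y} → x ⊏ y → x ⊑ x′ → x′ ⊏ y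
  ⊏-⊑ˡ (here a<b)  (refl ∷ _)    = here a<b
  ⊏-⊑ˡ (there x⊏y) (refl ∷ x⊑x′) = there (⊏-⊑ˡ x⊏y x⊑x′)

  ⊏-⊑ʳ : ∀ {x y y′} → x ⊏ y → y ⊑ y′ → x ⊏ y′
  ⊏-⊑ʳ (here a<b)  (refl ∷ _)    = here a<b
  ⊏-⊑ʳ (there x⊏y) (refl ∷ y⊑y′) = there (⊏-⊑ʳ x⊏y y⊑y′)

  ⊏-++ : ∀ {x y} u v → x ⊏ y → x ++ u ⊏ y ++ v
  ⊏-++ {x} {y} u v x⊏y = ⊏-⊑ʳ (⊏-⊑ˡ x⊏y (⊑-++ x u)) (⊑-++ y v)

  ⊏-++⁺ˡ : ∀ r {x y} → x ⊏ y → r ++ x ⊏ r ++ y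
  ⊏-++⁺ˡ []      x⊏y = x⊏y
  ⊏-++⁺ˡ (a ∷ r) x⊏y = there (⊏-++⁺ˡ r x⊏y)

  ⊏-++⁻ˡ : ∀ r {x y} → r ++ x ⊏ r ++ y → x ⊏ y
  ⊏-++⁻ˡ []      x⊏y           = x⊏y
  ⊏-++⁻ˡ (a ∷ r) (here a<a)    = contradiction a<a (<-irrefl refl)
  ⊏-++⁻ˡ (a ∷ r) (there rx⊏ry) = ⊏-++⁻ˡ r rx⊏ry

  ⊏-⊒ˡ : ∀ {x x′ y} → x ⊏ y → x′ ⊑ x → length y ≤ length x′ → x′ ⊏ y
  ⊏-⊒ˡ (here a<b)  (refl ∷ _)    _              = here a<b
  ⊏-⊒ˡ (there x⊏y) (refl ∷ x′⊑x) (s≤s |y|≤|x′|) = there (⊏-⊒ˡ x⊏y x′⊑x |y|≤|x′|)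
  ⊏-⊒ˡ {y = _ ∷ _} _ [] ()

  ⊏-transfer : ∀ {x x′ y z} → x ⊏ y → x ⊑ z → x′ ⊑ z → length y ≤ length x′ → x′ ⊏ y
  ⊏-transfer x⊏y x⊑z x′⊑z |y|≤|x′| with ⊑-total x⊑z x′⊑z
  ... | inj₁ x⊑x′ = ⊏-⊑ˡ x⊏y x⊑x′
  ... | inj₂ x′⊑x = ⊏-⊒ˡ x⊏y x′⊑x |y|≤|x′|

  ⊏-++⁻-equal-length : ∀ t z {a b} → length t ≡ length z → t ++ a ⊏ z ++ b →
                       t ⊏ z ⊎ (t ≡ z × a ⊏ b)
  ⊏-++⁻-equal-length []      []      _      ta⊏zb         = inj₂ (refl , ta⊏zb)
  ⊏-++⁻-equal-length (_ ∷ _) (_ ∷ _) _      (here c<d)    = inj₁ (here c<d)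
  ⊏-++⁻-equal-length (_ ∷ t) (_ ∷ z) |t|≡|z| (there ta⊏zb)
    with ⊏-++⁻-equal-length t z (ℕ.suc-injective |t|≡|z|) ta⊏zb
  ... | inj₁ t⊏z          = inj₁ (there t⊏z)
  ... | inj₂ (refl , a⊏b) = inj₂ (refl , a⊏b)

  data Comparison (x y : List A) : Set where
    prefix    : x ⊑ y → Comparison x y
    extension : y ⊑ x → Comparison x y
    below     : x ⊏ y → Comparison x y
    above     : y ⊏ x → Comparison x y

  compare : ∀ x y → Comparison x y
  compare []      y       = prefix []
  compare (a ∷ x) []      = extension []
  compare (a ∷ x) (b ∷ y) with <-cmp a b
  ... | tri< a<b _ _ = below (here a<b)
  ... | tri> _ _ b<a = above (here b<a)
  ... | tri≈ _ refl _ with compare x y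
  ...   | prefix x⊑y    = prefix (refl ∷ x⊑y)
  ...   | extension y⊑x = extension (refl ∷ y⊑x)
  ...   | below x⊏y     = below (there x⊏y)
  ...   | above y⊏x     = above (there y⊏x)

  infix 4 _⊏?_

  _⊏?_ : ∀ x y → Dec (x ⊏ y)
  x ⊏? y with compare x y
  ... | below x⊏y     = yes x⊏y
  ... | prefix x⊑y    = no λ x⊏y → ⊏⇒⋢ x⊏y x⊑y
  ... | extension y⊑x = no λ x⊏y → ⊏⇒⋣ x⊏y y⊑x
  ... | above y⊏x     = no (⊏-asym y⊏x)

  FirstDifference : List A → List A → Set
  FirstDifference x y = Σ (List A) λ r → Σ A λ a → Σ (List A) λ s → Σ A λ b → Σ (List A) λ t →
    (x ≡ r ++ (a ∷ s)) × (y ≡ r ++ (b ∷ t)) × a < b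

  ⊏⇒FirstDifference : ∀ {x y} → x ⊏ y → FirstDifference x y
  ⊏⇒FirstDifference (here {a} {b} {x} {y} a<b) = [] , a , x , b , y , refl , refl , a<b
  ⊏⇒FirstDifference (there {c} x⊏y)
    with r , a , s , b , t , refl , refl , a<b ← ⊏⇒FirstDifference x⊏y =
    c ∷ r , a , s , b , t , refl , refl , a<b

  ⊏⇒branch : ∀ {x y} → x ⊏ y → ∃ λ r → ∃₂ λ a b → r ∷ʳ a ⊑ x × r ∷ʳ b ⊑ y × a < b
  ⊏⇒branch x⊏y with r , a , _ , b , _ , refl , refl , a<b ← ⊏⇒FirstDifference x⊏y =
    r , a , b , ⊑-++⁺ˡ r (refl ∷ []) , ⊑-++⁺ˡ r (refl ∷ []) , a<b

  FirstDifference⇒⊏ : ∀ {x y} → FirstDifference x y → x ⊏ y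
  FirstDifference⇒⊏ (r , _ , _ , _ , _ , refl , refl , a<b) = ⊏-++⁺ˡ r (here a<b)

  Lex⇒⊏ : ∀ {x y} → Lex _<_ x y → ProperPrefix x y ⊎ x ⊏ y
  Lex⇒⊏ (inj₁ x⊂y)  = inj₁ x⊂y
  Lex⇒⊏ (inj₂ diff) = inj₂ (FirstDifference⇒⊏ diff)

  Lex-flip⇒⊏ : ∀ {x y} → Lex (flip _<_) x y → ProperPrefix x y ⊎ y ⊏ x
  Lex-flip⇒⊏ (inj₁ x⊂y) = inj₁ x⊂y
  Lex-flip⇒⊏ (inj₂ (r , a , s , b , t , refl , refl , b<a)) =
    inj₂ (FirstDifference⇒⊏ (r , b , t , a , s , refl , refl , b<a))

  ⊏⇒Lex : ∀ {x y} → x ⊏ y → Lex _<_ x y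
  ⊏⇒Lex = inj₂ ∘ ⊏⇒FirstDifference

  ⊏⇒≪ : ∀ {x y} → x ⊏ y → Lex _<_ x y × ¬ ProperPrefix x y
  ⊏⇒≪ x⊏y = ⊏⇒Lex x⊏y , λ (x≤ₚy , _) → ⊏⇒⋢ x⊏y (Prefix⇒⊑ x≤ₚy)

  ≪⇒⊏ : ∀ {x y} → Lex _<_ x y × ¬ ProperPrefix x y → x ⊏ y
  ≪⇒⊏ (x≺y , x⊄y) with Lex⇒⊏ x≺y
  ... | inj₁ x⊂y = contradiction x⊂y x⊄y
  ... | inj₂ x⊏y = x⊏y

  -- InvLyndon without the condition w ≢ [], and with s ≺ w unfolded: a proper
  -- suffix s ≺ w is either a prefix of w or s ⊏ w.
  InvLyndon′ : List A → Set
  InvLyndon′ w = ProperSuffixes (λ s → s ⊑ w ⊎ s ⊏ w) w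

  StrictlyInvLyndon : List A → Set
  StrictlyInvLyndon w = ProperSuffixes (_⊏ w) w

  StrictlyInvLyndon⇒InvLyndon′ : ∀ {w} → StrictlyInvLyndon w → InvLyndon′ w
  StrictlyInvLyndon⇒InvLyndon′ sil u s w≡us u≢[] s≢[] = inj₂ (sil u s w≡us u≢[] s≢[])

  proper-suffix-compare : ∀ {w} u s → w ≡ u ++ s → u ≢ [] → s ⊑ w ⊎ s ⊏ w ⊎ w ⊏ s
  proper-suffix-compare {w} u s w≡us u≢[] with compare s w
  ... | prefix s⊑w    = inj₁ s⊑w
  ... | below s⊏w     = inj₂ (inj₁ s⊏w)
  ... | above w⊏s     = inj₂ (inj₂ w⊏s)
  ... | extension w⊑s = contradiction (⊑-length w⊑s)
    (ℕ.<⇒≱ (subst (λ x → suc (length s) ≤ length x) (sym w≡us) (length-suffix< u s u≢[])))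

  ⊏-proper-suffix⇒¬InvLyndon′ : ∀ {w} u s → w ≡ u ++ s → u ≢ [] → s ≢ [] → w ⊏ s → ¬ InvLyndon′ w
  ⊏-proper-suffix⇒¬InvLyndon′ u s w≡us u≢[] s≢[] w⊏s inv = ⊏⇒⋡ w⊏s (inv u s w≡us u≢[] s≢[])

  InvLyndon′-[] : InvLyndon′ []
  InvLyndon′-[] u s []≡us u≢[] _ = contradiction (++-conicalˡ u s (sym []≡us)) u≢[]

  InvLyndon′-∷ : ∀ {a x} → Suffixes⁺ (¬_ ∘ (a ∷ x ⊏_)) x → InvLyndon′ (a ∷ x)
  InvLyndon′-∷ none []      s _    []≢[] _    = contradiction refl []≢[]
  InvLyndon′-∷ none (b ∷ u) s refl _     s≢[] with proper-suffix-compare (b ∷ u) s refl (λ ())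
  ... | inj₁ s⊑w          = inj₁ s⊑w
  ... | inj₂ (inj₁ s⊏w)   = inj₂ s⊏w
  ... | inj₂ (inj₂ w⊏s)   = contradiction w⊏s (none u s refl s≢[])

  InvLyndon′-⊑ : ∀ {x y} → x ⊑ y → InvLyndon′ y → InvLyndon′ x
  InvLyndon′-⊑ {x} x⊑y inv u s x≡us u≢[] s≢[] with z , refl ← ⊑⇒Prefix x⊑y
    with proper-suffix-compare u s x≡us u≢[]
  ... | inj₁ s⊑x        = inj₁ s⊑x
  ... | inj₂ (inj₁ s⊏x) = inj₂ s⊏x
  ... | inj₂ (inj₂ x⊏s) = contradiction inv
    (⊏-proper-suffix⇒¬InvLyndon′ u (s ++ z) (trans (cong (_++ z) x≡us) (++-assoc u s z))
      u≢[] (++-≢[]ˡ z s≢[]) (⊏-++ z z x⊏s))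

  InvLyndon′? : Decidable InvLyndon′
  InvLyndon′? [] = yes InvLyndon′-[]
  InvLyndon′? (a ∷ x) with shortest-suffix (a ∷ x ⊏?_) x
  ... | inj₁ (s , (u , refl) , s≢[] , w⊏s , _) =
    no (⊏-proper-suffix⇒¬InvLyndon′ (a ∷ u) s refl (λ ()) s≢[] w⊏s)
  ... | inj₂ none = yes (InvLyndon′-∷ none)

  ShortestNonInvLyndonPrefix : List A → List A → Set
  ShortestNonInvLyndonPrefix = ShortestPrefix (¬_ ∘ InvLyndon′)

  shortest-non-InvLyndon-prefix : ∀ w → ¬ InvLyndon′ w → ∃ (ShortestNonInvLyndonPrefix w)
  shortest-non-InvLyndon-prefix = shortest-prefix (¬? ∘ InvLyndon′?)

  InvLyndon′-before-shortest : ∀ {w P X} → ShortestNonInvLyndonPrefix w P → X ⊑ P → X ≢ P →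
                               InvLyndon′ X
  InvLyndon′-before-shortest (_ , _ , minimal) X⊑P X≢P =
    decidable-stable (InvLyndon′? _) (minimal _ X⊑P X≢P)

  InvLyndon′⇒⊑shortest : ∀ {w P X} → ShortestNonInvLyndonPrefix w P → X ⊑ w → InvLyndon′ X → X ⊑ P
  InvLyndon′⇒⊑shortest (P⊑w , ¬P-inv , _) X⊑w X-inv with ⊑-total X⊑w P⊑w
  ... | inj₁ X⊑P = X⊑P
  ... | inj₂ P⊑X = contradiction (InvLyndon′-⊑ P⊑X X-inv) ¬P-inv

  StrictlyInvLyndon⇒Suffixes⁺⊏ : ∀ {ℓ g} → StrictlyInvLyndon ℓ → ℓ ⊏ g → Suffixes⁺ (_⊏ g) ℓ
  StrictlyInvLyndon⇒Suffixes⁺⊏ ℓ-sil ℓ⊏g []      s refl _    = ℓ⊏g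
  StrictlyInvLyndon⇒Suffixes⁺⊏ ℓ-sil ℓ⊏g (a ∷ u) s ℓ≡us s≢[] =
    ⊏-trans (ℓ-sil (a ∷ u) s ℓ≡us (λ ()) s≢[]) ℓ⊏g

  Suffixes⁺-concat : ∀ {g ls} → All StrictlyInvLyndon ls → All (_⊏ g) ls →
                     Suffixes⁺ (_⊏ g) (concat ls)
  Suffixes⁺-concat [] [] u s []≡us s≢[] = contradiction (++-conicalʳ u s (sym []≡us)) s≢[]
  Suffixes⁺-concat {ls = ℓ ∷ ls} (ℓ-sil ∷ sils) (ℓ⊏g ∷ ls⊏g) u s ℓR≡us s≢[]
    with ++-≡-++ ℓ (concat ls) u s ℓR≡us
  ... | inj₂ (u″ , R≡u″s) = Suffixes⁺-concat sils ls⊏g u″ s R≡u″s s≢[]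
  ... | inj₁ (u′ , s′ , ℓ≡u′s′ , refl , s′≢[]) =
    ⊏-⊑ˡ (StrictlyInvLyndon⇒Suffixes⁺⊏ ℓ-sil ℓ⊏g u′ s′ ℓ≡u′s′ s′≢[]) (⊑-++ s′ (concat ls))

module _ {n : ℕ} where

  open LexOrder (Fin.<-isStrictTotalOrder {n})

  _≟_ : (x y : Word n) → Dec (x ≡ y)
  _≟_ = ≡-dec Fin._≟_

  InvLyndon⇒InvLyndon′ : ∀ {w} → InvLyndon w → InvLyndon′ w
  InvLyndon⇒InvLyndon′ (_ , inv) u s w≡us u≢[] s≢[] with Lex⇒⊏ (inv u s w≡us u≢[] s≢[])
  ... | inj₁ (s≤ₚw , _) = inj₁ (Prefix⇒⊑ s≤ₚw)
  ... | inj₂ s⊏w        = inj₂ s⊏w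

  InvLyndon′⇒InvLyndon : ∀ {w} → w ≢ [] → InvLyndon′ w → InvLyndon w
  InvLyndon′⇒InvLyndon {w} w≢[] inv =
    w≢[] , λ u s w≡us u≢[] s≢[] → ≺w u s w≡us u≢[] (inv u s w≡us u≢[] s≢[])
    where
    ≺w : ∀ u s → w ≡ u ++ s → u ≢ [] → s ⊑ w ⊎ s ⊏ w → s ≺ w
    ≺w u s w≡us u≢[] (inj₂ s⊏w) = ⊏⇒Lex s⊏w
    ≺w u s w≡us u≢[] (inj₁ s⊑w) = inj₁ (⊑⇒Prefix s⊑w , λ s≡w →
      ℕ.<-irrefl (cong length (trans s≡w w≡us)) (length-suffix< u s u≢[]))

  commuting⇒¬Primitive : ∀ (x y : Word n) → x ≢ [] → y ≢ [] → x ++ y ≡ y ++ x →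
                         ¬ Primitive (x ++ y)
  commuting⇒¬Primitive x y x≢[] y≢[] xy≡yx prim
    with u , i , j , refl , refl ← commuting⇒powers x y (<-wellFounded _) xy≡yx =
    ℕ.<-irrefl (sym (prim u (i + j) (sym (^-+ u i j))))
               (ℕ.+-mono-≤ (nonzero i x≢[]) (nonzero j y≢[]))
    where
    nonzero : ∀ k → u ^ k ≢ [] → 1 ≤ k
    nonzero zero    u⁰≢[] = contradiction refl u⁰≢[]
    nonzero (suc k) _     = s≤s z≤n

  AntiLyndon-conjugate : ∀ {w} → AntiLyndon w → ∀ u v → w ≡ u ++ v → v ++ u ≡ w ⊎ v ++ u ⊏ w
  AntiLyndon-conjugate {w} (_ , _ , least) u v w≡uv with (v ++ u) ≟ w
  ... | yes vu≡w = inj₁ vu≡w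
  ... | no vu≢w with Lex-flip⇒⊏ (least u v w≡uv vu≢w)
  ...   | inj₂ vu⊏w        = inj₂ vu⊏w
  ...   | inj₁ (w≤ₚvu , _) = contradiction (sym (⊑-longer⇒≡ (Prefix⇒⊑ w≤ₚvu)
    (ℕ.≤-reflexive (trans (length-++-comm v u) (cong length (sym w≡uv)))))) vu≢w

  -- For w = u s = s t, the conjugates s u and t s differ from w (else u, s commute,
  -- resp. t = u), so both lie ⊏-below w; this gives u ⊏ t, and t ⊏ u since |t| = |u|.
  AntiLyndon-unbordered : ∀ {w} → AntiLyndon w → ∀ u s t → w ≡ u ++ s → w ≡ s ++ t →
                          u ≢ [] → s ≢ [] → ⊥
  AntiLyndon-unbordered {w} anti@(_ , prim , _) u s t w≡us w≡st u≢[] s≢[]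
    with AntiLyndon-conjugate anti u s w≡us
  ... | inj₁ su≡w = commuting⇒¬Primitive u s u≢[] s≢[] (trans (sym w≡us) (sym su≡w))
                                                      (subst Primitive w≡us prim)
  ... | inj₂ su⊏w with u⊏t ← ⊏-++⁻ˡ s (subst (s ++ u ⊏_) w≡st su⊏w)
    with AntiLyndon-conjugate anti s t w≡st
  ...   | inj₁ ts≡w = ⊏-irrefl (subst (u ⊏_) (++-cancelʳ s t u (trans ts≡w w≡us)) u⊏t)
  ...   | inj₂ ts⊏w with ⊏-++⁻-equal-length t u |t|≡|u| (subst (t ++ s ⊏_) w≡us ts⊏w)
    where
    |t|≡|u| : length t ≡ length u
    |t|≡|u| = ℕ.+-cancelˡ-≡ (length s) _ _ (begin
      length s + length t ≡⟨ length-++ s ⟨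
      length (s ++ t)     ≡⟨ cong length (trans (sym w≡st) w≡us) ⟩
      length (u ++ s)     ≡⟨ length-++-comm u s ⟩
      length (s ++ u)     ≡⟨ length-++ s ⟩
      length s + length u ∎)
  ...     | inj₁ t⊏u       = ⊏-asym t⊏u u⊏t
  ...     | inj₂ (_ , s⊏s) = ⊏-irrefl s⊏s

  AntiLyndon⇒StrictlyInvLyndon : ∀ {w} → AntiLyndon w → StrictlyInvLyndon w
  AntiLyndon⇒StrictlyInvLyndon {w} anti u s w≡us u≢[] s≢[]
    with proper-suffix-compare u s w≡us u≢[]
  ... | inj₂ (inj₁ s⊏w) = s⊏w
  ... | inj₁ s⊑w with t , st≡w ← ⊑⇒Prefix s⊑w =
    ⊥-elim (AntiLyndon-unbordered anti u s t w≡us (sym st≡w) u≢[] s≢[])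
  ... | inj₂ (inj₂ w⊏s) with AntiLyndon-conjugate anti u s w≡us
  ...   | inj₁ su≡w = ⊥-elim (⊏-irrefl (subst (w ⊏_) su≡w (⊏-⊑ʳ w⊏s (⊑-++ s u))))
  ...   | inj₂ su⊏w = ⊥-elim (⊏-asym su⊏w (⊏-⊑ʳ w⊏s (⊑-++ s u)))

  -- Canonical pairs

  -- A working form of CanonicalPair: the conditions on p and on the words p z′ say
  -- exactly that p q is the shortest prefix of w that is not inverse Lyndon.
  record Canonical (w p v q : Word n) : Set where
    field
      split    : w ≡ p ++ v
      p≢[]     : p ≢ []
      v≢[]     : v ≢ []
      q≢[]     : q ≢ []
      q⊑v      : q ⊑ v
      q-inv    : InvLyndon′ q
      p⊏q      : p ⊏ q
      shortest : ShortestNonInvLyndonPrefix w (p ++ q)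

  CanonicalPair⇒Canonical : ∀ {w p v q} → CanonicalPair w p v q → Canonical w p v q
  CanonicalPair⇒Canonical {w} {p} {v} {q}
    (w≡pv , p≢[] , v≢[] , p-inv , q≢[] , q≤ₚv , q-inv , extensions-inv , ¬pq-inv , p≪q) = record
    { split = w≡pv ; p≢[] = p≢[] ; v≢[] = v≢[] ; q≢[] = q≢[] ; q⊑v = Prefix⇒⊑ q≤ₚv
    ; q-inv = InvLyndon⇒InvLyndon′ q-inv ; p⊏q = ≪⇒⊏ p≪q
    ; shortest = subst (p ++ q ⊑_) (sym w≡pv) (⊑-++⁺ˡ p (Prefix⇒⊑ q≤ₚv))
               , ¬pq-inv ∘ InvLyndon′⇒InvLyndon (++-≢[]ˡ q p≢[])
               , λ X X⊑pq X≢pq ¬X-inv → ¬X-inv (before X X⊑pq X≢pq)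
    }
    where
    before : ∀ X → X ⊑ p ++ q → X ≢ p ++ q → InvLyndon′ X
    before X X⊑pq X≢pq with ⊑-total X⊑pq (⊑-++ p q)
    ... | inj₁ X⊑p = InvLyndon′-⊑ X⊑p (InvLyndon⇒InvLyndon′ p-inv)
    ... | inj₂ p⊑X with z , refl ← ⊑⇒Prefix p⊑X with z ≟ []
    ...   | yes refl = subst InvLyndon′ (sym (++-identityʳ p)) (InvLyndon⇒InvLyndon′ p-inv)
    ...   | no z≢[]  = InvLyndon⇒InvLyndon′
      (extensions-inv z (⊑⇒Prefix (⊑-++⁻ˡ p X⊑pq) , X≢pq ∘ cong (p ++_)) z≢[])

  Canonical⇒CanonicalPair : ∀ {w p v q} → Canonical w p v q → CanonicalPair w p v q
  Canonical⇒CanonicalPair {w} {p} {v} {q} c =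
    split , p≢[] , v≢[] , InvLyndon′⇒InvLyndon p≢[] (before (⊑-++ p q) (≢[]⇒≢++ p q≢[])) ,
    q≢[] , ⊑⇒Prefix q⊑v , InvLyndon′⇒InvLyndon q≢[] q-inv ,
    (λ z (z≤ₚq , z≢q) z≢[] → InvLyndon′⇒InvLyndon (++-≢[]ʳ p z≢[])
      (before (⊑-++⁺ˡ p (Prefix⇒⊑ z≤ₚq)) (z≢q ∘ ++-cancelˡ p _ _))) ,
    proj₁ (proj₂ shortest) ∘ InvLyndon⇒InvLyndon′ , ⊏⇒≪ p⊏q
    where
    open Canonical c
    before : ∀ {X} → X ⊑ p ++ q → X ≢ p ++ q → InvLyndon′ X
    before = InvLyndon′-before-shortest shortest

  Canonical-++ : ∀ {x p v q} y → Canonical x p v q → Canonical (x ++ y) p (v ++ y) q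
  Canonical-++ {x} {p} {v} {q} y c = record
    { split = trans (cong (_++ y) split) (++-assoc p v y)
    ; p≢[] = p≢[] ; v≢[] = ++-≢[]ˡ y v≢[] ; q≢[] = q≢[] ; q⊑v = ⊑-trans q⊑v (⊑-++ v y)
    ; q-inv = q-inv ; p⊏q = p⊏q
    ; shortest = map₁ (λ pq⊑x → ⊑-trans pq⊑x (⊑-++ x y)) shortest
    }
    where open Canonical c

  CanonicalPair-++ : ∀ {x p v q} y → CanonicalPair x p v q → CanonicalPair (x ++ y) p (v ++ y) q
  CanonicalPair-++ y = Canonical⇒CanonicalPair ∘ Canonical-++ y ∘ CanonicalPair⇒Canonical

  -- Reading Q c ⊏ q′ c inside Q = p q′: q′ is a proper suffix of the inverse Lyndon
  -- word Q, hence a prefix of it, and the letter following it in Q is below c.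
  next-letter< : ∀ p q′ {c} → p ≢ [] → InvLyndon′ (p ++ q′) → p ++ q′ ++ [ c ] ⊏ q′ ++ [ c ] →
                 ∃ λ d → q′ ∷ʳ d ⊑ p ++ q′ × d <ᶠ c
  next-letter< p q′ {c} p≢[] Q-inv Qc⊏q′c with q′⊑Q
    where
    q′⊑Q : q′ ⊑ p ++ q′
    q′⊑Q with q′ ≟ []
    ... | yes refl = []
    ... | no q′≢[] with Q-inv p q′ refl p≢[] q′≢[]
    ...   | inj₁ q′⊑Q = q′⊑Q
    ...   | inj₂ q′⊏Q = ⊥-elim (⊏-asym Qc⊏q′c
      (subst (q′ ++ [ c ] ⊏_) (++-assoc p q′ [ c ]) (⊏-++ [ c ] [ c ] q′⊏Q)))
  ... | q′⊑Q with ⊑⇒Prefix q′⊑Q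
  ...   | [] , q′≡Q = ⊥-elim (ℕ.<-irrefl (cong length (trans (sym (++-identityʳ q′)) q′≡Q))
                                        (length-suffix< p q′ p≢[]))
  ...   | d ∷ e , q′de≡Q with ⊏-++⁻ˡ q′ (subst (_⊏ q′ ++ [ c ]) (begin
    p ++ q′ ++ [ c ]         ≡⟨ ++-assoc p q′ [ c ] ⟨
    (p ++ q′) ++ [ c ]       ≡⟨ cong (_++ [ c ]) q′de≡Q ⟨
    (q′ ++ d ∷ e) ++ [ c ]   ≡⟨ ++-assoc q′ (d ∷ e) [ c ] ⟩
    q′ ++ d ∷ e ++ [ c ]     ∎) Qc⊏q′c)
  ...     | here d<c = d , subst (q′ ∷ʳ d ⊑_) q′de≡Q (⊑-++⁺ˡ q′ (refl ∷ [])) , d<c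

  shortest-⊏-suffix⇒InvLyndon′ : ∀ {P q} → P ⊏ q → ProperSuffixes (¬_ ∘ (P ⊏_)) q → InvLyndon′ q
  shortest-⊏-suffix⇒InvLyndon′ P⊏q minimal u s q≡us u≢[] s≢[]
    with proper-suffix-compare u s q≡us u≢[]
  ... | inj₁ s⊑q        = inj₁ s⊑q
  ... | inj₂ (inj₁ s⊏q) = inj₂ s⊏q
  ... | inj₂ (inj₂ q⊏s) = contradiction (⊏-trans P⊏q q⊏s) (minimal u s q≡us u≢[] s≢[])

  -- If p ⊑ q, write q = p T c; the letter after p T in p q is some d < c, so the
  -- shorter proper suffix T c of q would already lie ⊏-above p q.
  shortest-⊏-suffix⇒⊏ : ∀ {w} p q → p ≢ [] → ShortestNonInvLyndonPrefix w (p ++ q) →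
    p ++ q ⊏ q → ProperSuffixes (¬_ ∘ (p ++ q ⊏_)) q → p ⊏ q
  shortest-⊏-suffix⇒⊏ p q p≢[] shortest P⊏q minimal with compare p q
  ... | below p⊏q     = p⊏q
  ... | above q⊏p     = ⊥-elim (⊏-asym P⊏q (⊏-⊑ʳ q⊏p (⊑-++ p q)))
  ... | extension q⊑p = ⊥-elim (⊏⇒⋣ P⊏q (⊑-trans q⊑p (⊑-++ p q)))
  ... | prefix p⊑q with initLast q
  ...   | [] = ⊥-elim (p≢[] (⊑-longer⇒≡ p⊑q z≤n))
  ...   | q′ ∷ʳ′ c with ⊑-∷ʳ q′ c p⊑q
  ...     | inj₂ refl = ⊥-elim (⊏⇒⋣ P⊏q (⊑-++ p q))
  ...     | inj₁ p⊑q′ with T , refl ← ⊑⇒Prefix p⊑q′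
    with d , q′d⊑Q , d<c ← next-letter< p q′ p≢[]
           (InvLyndon′-before-shortest shortest (⊑-++⁺ˡ p (⊑-++ q′ [ c ]))
                                                 (≢[]⇒≢++ q′ (λ ()) ∘ ++-cancelˡ p _ _))
           P⊏q
    = ⊥-elim (minimal p (T ∷ʳ c) (++-assoc p T [ c ]) p≢[] (++-≢[]ʳ T (λ ())) P⊏Tc)
    where
    Td⊑q′ : T ∷ʳ d ⊑ p ++ T
    Td⊑q′ = ⊑-++⁻ˡ p (subst (_⊑ p ++ p ++ T) (++-assoc p T [ d ]) q′d⊑Q)
    P⊏Tc : p ++ q ⊏ T ∷ʳ c
    P⊏Tc = ⊏-⊑ˡ (⊏-++⁺ˡ T (here d<c)) (⊑-trans Td⊑q′ (⊑-trans (⊑-++ (p ++ T) [ d ])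
      (⊑-trans q′d⊑Q (⊑-++⁺ˡ p (⊑-++ (p ++ T) [ c ])))))

  canonical-exists : ∀ w → ¬ InvLyndon′ w → ∃₂ λ p v → ∃ (Canonical w p v)
  canonical-exists w ¬w-inv with shortest-non-InvLyndon-prefix w ¬w-inv
  ... | [] , _ , ¬[]-inv , _ = contradiction InvLyndon′-[] ¬[]-inv
  ... | a ∷ P′ , P⊑w , ¬P-inv , minimal with shortest-suffix (a ∷ P′ ⊏?_) P′
  ...   | inj₂ none = contradiction (InvLyndon′-∷ none) ¬P-inv
  ...   | inj₁ (q , (u , refl) , q≢[] , P⊏q , q-minimal) with R , refl ← ⊑⇒Prefix P⊑w =
    a ∷ u , q ++ R , q , record
      { split = ++-assoc (a ∷ u) q R ; p≢[] = λ () ; v≢[] = ++-≢[]ˡ R q≢[] ; q≢[] = q≢[]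
      ; q⊑v = ⊑-++ q R
      ; q-inv = shortest-⊏-suffix⇒InvLyndon′ P⊏q q-minimal
      ; p⊏q = shortest-⊏-suffix⇒⊏ (a ∷ u) q (λ ()) shortest P⊏q q-minimal
      ; shortest = shortest
      }
    where
    shortest : ShortestNonInvLyndonPrefix (a ∷ (u ++ q) ++ R) (a ∷ u ++ q)
    shortest = P⊑w , ¬P-inv , minimal

  canonical-shortest-unique : ∀ {w p₁ v₁ q₁ p₂ v₂ q₂} →
    Canonical w p₁ v₁ q₁ → Canonical w p₂ v₂ q₂ → p₁ ++ q₁ ≡ p₂ ++ q₂
  canonical-shortest-unique c₁ c₂ =
    shortest-prefix-unique (Canonical.shortest c₁) (Canonical.shortest c₂)

  -- With p₂ = p₁ u and q₁ = u q₂ (u ≢ []), write q₂ = q₂′ c; in Q = p₂ q₂′ the prefix q₂′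
  -- is followed by some d < c, and q₁′ = u q₂′ is a longer prefix of Q, so q₁ ⊏ q₂:
  -- the proper suffix q₂ of the inverse Lyndon word q₁ would lie ⊏-above it.
  canonical-⊑⇒≡ : ∀ {w p₁ v₁ q₁ p₂ v₂ q₂} → Canonical w p₁ v₁ q₁ → Canonical w p₂ v₂ q₂ →
                  p₁ ⊑ p₂ → p₁ ≡ p₂
  canonical-⊑⇒≡ {p₁ = p₁} {q₁ = q₁} {q₂ = q₂} c₁ c₂ p₁⊑p₂ with u , refl ← ⊑⇒Prefix p₁⊑p₂ with u ≟ []
  ... | yes refl = sym (++-identityʳ p₁)
  ... | no u≢[] with refl ← ++-cancelˡ p₁ q₁ (u ++ q₂)
                     (trans (canonical-shortest-unique c₁ c₂) (++-assoc p₁ u q₂))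
    with initLast q₂
  ...   | [] = ⊥-elim (Canonical.q≢[] c₂ refl)
  ...   | q₂′ ∷ʳ′ c =
    ⊥-elim (⊏⇒⋡ q₁⊏q₂ (Canonical.q-inv c₁ u (q₂′ ∷ʳ c) refl u≢[] (++-≢[]ʳ q₂′ (λ ()))))
    where
    Q-inv : InvLyndon′ ((p₁ ++ u) ++ q₂′)
    Q-inv = InvLyndon′-before-shortest (Canonical.shortest c₂)
      (⊑-++⁺ˡ (p₁ ++ u) (⊑-++ q₂′ [ c ])) (≢[]⇒≢++ q₂′ (λ ()) ∘ ++-cancelˡ (p₁ ++ u) _ _)
    P⊏q₁ : (p₁ ++ u) ++ q₂′ ∷ʳ c ⊏ u ++ q₂′ ∷ʳ c
    P⊏q₁ = subst (_⊏ u ++ q₂′ ∷ʳ c) (sym (++-assoc p₁ u (q₂′ ∷ʳ c)))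
      (⊏-⊑ˡ (Canonical.p⊏q c₁) (⊑-++ p₁ (u ++ q₂′ ∷ʳ c)))
    q₁′⊑Q : u ++ q₂′ ⊑ (p₁ ++ u) ++ q₂′
    q₁′⊑Q with Q-inv p₁ (u ++ q₂′) (++-assoc p₁ u q₂′) (Canonical.p≢[] c₁) (++-≢[]ˡ q₂′ u≢[])
    ... | inj₁ q₁′⊑Q = q₁′⊑Q
    ... | inj₂ q₁′⊏Q = ⊥-elim (⊏-asym P⊏q₁
      (subst₂ _⊏_ (++-assoc u q₂′ [ c ]) (++-assoc (p₁ ++ u) q₂′ [ c ]) (⊏-++ [ c ] [ c ] q₁′⊏Q)))
    q₁⊏q₂ : u ++ q₂′ ∷ʳ c ⊏ q₂′ ∷ʳ c
    q₁⊏q₂ with d , q₂′d⊑Q , d<c ← next-letter< (p₁ ++ u) q₂′ (++-≢[]ˡ u (Canonical.p≢[] c₁)) Q-inv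
                                     (⊏-⊑ˡ (Canonical.p⊏q c₂) (⊑-++ (p₁ ++ u) (q₂′ ∷ʳ c)))
      = ⊏-⊑ˡ (⊏-++⁺ˡ q₂′ (here {x = []} d<c)) (⊑-trans
          (⊑-by-length q₂′d⊑Q q₁′⊑Q (subst (_≤ length (u ++ q₂′)) (length-++-comm [ d ] q₂′)
                                                (length-suffix< u q₂′ u≢[])))
          (subst (u ++ q₂′ ⊑_) (++-assoc u q₂′ [ c ]) (⊑-++ (u ++ q₂′) [ c ])))

  canonical-unique : ∀ {w p₁ v₁ q₁ p₂ v₂ q₂} → Canonical w p₁ v₁ q₁ → Canonical w p₂ v₂ q₂ →
                     p₁ ≡ p₂ × v₁ ≡ v₂ × q₁ ≡ q₂
  canonical-unique {w} {p₁} {v₁} {q₁} {p₂} {v₂} {q₂} c₁ c₂ with p₁≡p₂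
    where
    p₁≡p₂ : p₁ ≡ p₂
    p₁≡p₂ with ⊑-total (subst (p₁ ⊑_) (sym (Canonical.split c₁)) (⊑-++ p₁ v₁))
                       (subst (p₂ ⊑_) (sym (Canonical.split c₂)) (⊑-++ p₂ v₂))
    ... | inj₁ p₁⊑p₂ = canonical-⊑⇒≡ c₁ c₂ p₁⊑p₂
    ... | inj₂ p₂⊑p₁ = sym (canonical-⊑⇒≡ c₂ c₁ p₂⊑p₁)
  ... | refl = refl
             , ++-cancelˡ p₁ v₁ v₂ (trans (sym (Canonical.split c₁)) (Canonical.split c₂))
             , ++-cancelˡ p₁ q₁ q₂ (canonical-shortest-unique c₁ c₂)

  -- The inverse Lyndon factorization

  CanonicalPair-unique : ∀ {w p₁ v₁ q₁ p₂ v₂ q₂} →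
    CanonicalPair w p₁ v₁ q₁ → CanonicalPair w p₂ v₂ q₂ → p₁ ≡ p₂ × v₁ ≡ v₂ × q₁ ≡ q₂
  CanonicalPair-unique pair₁ pair₂ =
    canonical-unique (CanonicalPair⇒Canonical pair₁) (CanonicalPair⇒Canonical pair₂)

  IsICFL⇒≢[] : ∀ {w : Word n} {ms} → IsICFL w ms → w ≢ []
  IsICFL⇒≢[] (icfl-inv (w≢[] , _))           = w≢[]
  IsICFL⇒≢[] (icfl-1 _ (w≡pv , p≢[] , _) _ _)   = ++-≢[]ˡ _ p≢[] ∘ trans (sym w≡pv)
  IsICFL⇒≢[] (icfl-2 _ (w≡pv , p≢[] , _) _ _ _) = ++-≢[]ˡ _ p≢[] ∘ trans (sym w≡pv)

  IsICFL⇒concat : ∀ {w : Word n} {ms} → IsICFL w ms → concat ms ≡ w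
  IsICFL⇒concat {w} (icfl-inv _) = ++-identityʳ w
  IsICFL⇒concat (icfl-1 {p = p} _ (w≡pv , _) v-icfl _) =
    trans (cong (p ++_) (IsICFL⇒concat v-icfl)) (sym w≡pv)
  IsICFL⇒concat (icfl-2 {p = p} {m = m} {ms = ms} _ (w≡pv , _) v-icfl _ _) =
    trans (++-assoc p m (concat ms)) (trans (cong (p ++_) (IsICFL⇒concat v-icfl)) (sym w≡pv))

  ICFL-cases-exclusive : ∀ {q m r : Word n} {b} → q ≡ r ∷ʳ b → Prefix q m → ¬ Prefix m r
  ICFL-cases-exclusive {r = r} {b} refl q≤ₚm m≤ₚr =
    ℕ.<⇒≱ (length-prefix< r [ b ] (λ ())) (⊑-length (⊑-trans (Prefix⇒⊑ q≤ₚm) (Prefix⇒⊑ m≤ₚr)))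

  IsICFL-functional : ∀ {w : Word n} {ms ms′} → IsICFL w ms → IsICFL w ms′ → ms ≡ ms′
  IsICFL-functional (icfl-inv _)         (icfl-inv _)           = refl
  IsICFL-functional (icfl-inv inv)       (icfl-1 ¬inv _ _ _)    = contradiction inv ¬inv
  IsICFL-functional (icfl-inv inv)       (icfl-2 ¬inv _ _ _ _)  = contradiction inv ¬inv
  IsICFL-functional (icfl-1 ¬inv _ _ _)   (icfl-inv inv)        = contradiction inv ¬inv
  IsICFL-functional (icfl-2 ¬inv _ _ _ _) (icfl-inv inv)        = contradiction inv ¬inv
  IsICFL-functional (icfl-1 _ pair v-icfl _) (icfl-1 _ pair′ v-icfl′ _)
    with refl , refl , refl ← CanonicalPair-unique pair pair′
    with refl ← IsICFL-functional v-icfl v-icfl′ = refl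
  IsICFL-functional (icfl-1 _ pair v-icfl q≤ₚm) (icfl-2 _ pair′ v-icfl′ q≡rb m≤ₚr)
    with refl , refl , refl ← CanonicalPair-unique pair pair′
    with refl ← IsICFL-functional v-icfl v-icfl′ = ⊥-elim (ICFL-cases-exclusive q≡rb q≤ₚm m≤ₚr)
  IsICFL-functional (icfl-2 _ pair v-icfl q≡rb m≤ₚr) (icfl-1 _ pair′ v-icfl′ q≤ₚm)
    with refl , refl , refl ← CanonicalPair-unique pair pair′
    with refl ← IsICFL-functional v-icfl v-icfl′ = ⊥-elim (ICFL-cases-exclusive q≡rb q≤ₚm m≤ₚr)
  IsICFL-functional (icfl-2 _ pair v-icfl _ _) (icfl-2 _ pair′ v-icfl′ _ _)
    with refl , refl , refl ← CanonicalPair-unique pair pair′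
    with refl ← IsICFL-functional v-icfl v-icfl′ = refl

  IsICFL-extend : ∀ {w p v q m ms} → ¬ InvLyndon w → CanonicalPair w p v q → IsICFL v (m ∷ ms) →
                ∃ (IsICFL w)
  IsICFL-extend {v = v} {q} {m} {ms} ¬inv pair v-icfl
    with ⊑-total (Canonical.q⊑v (CanonicalPair⇒Canonical pair))
                 (subst (m ⊑_) (IsICFL⇒concat v-icfl) (⊑-++ m (concat ms)))
  ... | inj₁ q⊑m = _ , icfl-1 ¬inv pair v-icfl (⊑⇒Prefix q⊑m)
  ... | inj₂ m⊑q with initLast q
  ...   | [] = ⊥-elim (Canonical.q≢[] (CanonicalPair⇒Canonical pair) refl)
  ...   | r ∷ʳ′ b with ⊑-∷ʳ r b m⊑q
  ...     | inj₁ m⊑r = _ , icfl-2 ¬inv pair v-icfl refl (⊑⇒Prefix m⊑r)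
  ...     | inj₂ refl = _ , icfl-1 ¬inv pair v-icfl (⊑⇒Prefix ⊑-refl)

  IsICFL-exists : ∀ w → Acc _<_ (length w) → w ≢ [] → ∃ (IsICFL w)
  IsICFL-exists w (acc rec) w≢[] with InvLyndon′? w
  ... | yes inv = w ∷ [] , icfl-inv (InvLyndon′⇒InvLyndon w≢[] inv)
  ... | no ¬inv with p , v , q , c ← canonical-exists w ¬inv
    with IsICFL-exists v (rec (subst (λ w → length v < length w) (sym (Canonical.split c))
                                     (length-suffix< p v (Canonical.p≢[] c))))
                       (Canonical.v≢[] c)
  ...   | [] , ()
  ...   | _ ∷ _ , v-icfl =
    IsICFL-extend (¬inv ∘ InvLyndon⇒InvLyndon′) (Canonical⇒CanonicalPair c) v-icfl

  -- Gluing factorizations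

  ¬InvLyndon-++ : ∀ {x} y → x ≢ [] → ¬ InvLyndon x → ¬ InvLyndon (x ++ y)
  ¬InvLyndon-++ {x} y x≢[] ¬x-inv =
    ¬x-inv ∘ InvLyndon′⇒InvLyndon x≢[] ∘ InvLyndon′-⊑ (⊑-++ x y) ∘ InvLyndon⇒InvLyndon′

  -- If g = p g″ with g″ ≢ [], then g ⊑ p q (g is inverse Lyndon) makes g″ a prefix of q,
  -- and g″ ⊏ g gives p ⊏ q ⊏ g, contradicting p ⊑ g.
  canonical-prefix-⊒ : ∀ {g y p v q} → StrictlyInvLyndon g → g ⊑ y → Canonical y p v q →
                       g ⊑ p
  canonical-prefix-⊒ {g} {y} {p} {v} {q} g-sil g⊑y c
    with ⊑-total g⊑y (subst (p ⊑_) (sym (Canonical.split c)) (⊑-++ p v))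
  ... | inj₁ g⊑p = g⊑p
  ... | inj₂ p⊑g with g″ , refl ← ⊑⇒Prefix p⊑g with g″ ≟ []
  ...   | yes refl = subst (_⊑ p) (sym (++-identityʳ p)) ⊑-refl
  ...   | no g″≢[] = ⊥-elim (⊏⇒⋢ (⊏-trans (Canonical.p⊏q c) q⊏g) (⊑-++ p g″))
    where
    g⊑pq : p ++ g″ ⊑ p ++ q
    g⊑pq = InvLyndon′⇒⊑shortest (Canonical.shortest c) g⊑y
                                (StrictlyInvLyndon⇒InvLyndon′ g-sil)
    q⊏g : q ⊏ p ++ g″
    q⊏g = ⊏-⊑ˡ (g-sil p g″ refl (Canonical.p≢[] c) g″≢[]) (⊑-++⁻ˡ p g⊑pq)

  first-factor-⊒ : ∀ {g y ns} → StrictlyInvLyndon g → g ⊑ y → IsICFL y ns →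
                   ∃₂ λ m ms → ns ≡ m ∷ ms × g ⊑ m
  first-factor-⊒ g-sil g⊑y (icfl-inv _) = _ , _ , refl , g⊑y
  first-factor-⊒ g-sil g⊑y (icfl-1 _ pair _ _) =
    _ , _ , refl , canonical-prefix-⊒ g-sil g⊑y (CanonicalPair⇒Canonical pair)
  first-factor-⊒ g-sil g⊑y (icfl-2 {p = p} {m = m} _ pair _ _ _) =
    _ , _ , refl ,
    ⊑-trans (canonical-prefix-⊒ g-sil g⊑y (CanonicalPair⇒Canonical pair)) (⊑-++ p m)

  -- z q ⊑ r b ⊑ g makes z q inverse Lyndon; but |q| ≤ |r|, so p ⊏ q already shows
  -- r ⊏ q, hence z q ⊏ q for its proper suffix q.
  overshoot-impossible : ∀ {g p z q r b} → StrictlyInvLyndon g → z ≢ [] → q ≢ [] →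
                         p ⊏ q → r ⊑ p → r ∷ʳ b ⊑ g → z ++ q ⊑ r ∷ʳ b → ⊥
  overshoot-impossible {g} {p} {z} {q} {r} {b} g-sil z≢[] q≢[] p⊏q r⊑p rb⊑g zq⊑rb =
    ⊏⇒⋡ zq⊏q (InvLyndon′-⊑ zq⊑g (StrictlyInvLyndon⇒InvLyndon′ g-sil) z q refl z≢[] q≢[])
    where
    zq⊑g : z ++ q ⊑ g
    zq⊑g = ⊑-trans zq⊑rb rb⊑g
    |q|≤|r| : length q ≤ length r
    |q|≤|r| = ℕ.≤-pred (ℕ.≤-trans (length-suffix< z q z≢[])
                (subst (length (z ++ q) ≤_) (length-++-comm r [ b ]) (⊑-length zq⊑rb)))
    zq⊏q : z ++ q ⊏ q
    zq⊏q = ⊏-transfer (⊏-⊒ˡ p⊏q r⊑p |q|≤|r|) (⊑-trans (⊑-++ r [ b ]) rb⊑g) zq⊑g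
             (subst (length q ≤_) (sym (length-++ z)) (ℕ.m≤n+m (length q) (length z)))

  -- Let r a ⊑ x and r b ⊑ g with a < b. The word x r b is not inverse Lyndon, so the
  -- canonical pair (p, q) of x y has x ⊑ p q ⊑ x r b. If p = x this is the first case
  -- of the recursive definition of ICFL(x y); if p is shorter than x, the rest of x
  -- is a prefix of q and we are in the second case; p cannot be longer than x.
  glue-InvLyndon : ∀ {g y ns} → StrictlyInvLyndon g → g ⊑ y → IsICFL y ns →
                   ∀ x → Acc _<_ (length x) → InvLyndon x → Suffixes⁺ (_⊏ g) x →
                   IsICFL (x ++ y) (x ∷ ns)
  glue-InvLyndon {g} {y} {ns} g-sil g⊑y y-icfl x (acc rec) x-inv@(x≢[] , _) x-below
    with x⊏g ← x-below [] x refl x≢[]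
    with r , a , b , ra⊑x , rb⊑g , a<b ← ⊏⇒branch x⊏g
    with ¬xy-inv ← ⊏-proper-suffix⇒¬InvLyndon′ x y refl x≢[] (IsICFL⇒≢[] y-icfl)
                     (⊏-⊑ˡ (⊏-⊑ʳ x⊏g g⊑y) (⊑-++ x y))
    with p , v , q , c ← canonical-exists (x ++ y) ¬xy-inv
    with pq⊑xrb ← shortest-prefix-⊑ (Canonical.shortest c) (⊑-++⁺ˡ x (⊑-trans rb⊑g g⊑y))
                    (⊏-proper-suffix⇒¬InvLyndon′ x (r ∷ʳ b) refl x≢[] (++-≢[]ʳ r (λ ()))
                      (⊏-⊑ˡ (⊏-++⁺ˡ r (here a<b)) (⊑-trans ra⊑x (⊑-++ x (r ∷ʳ b)))))
    with p ≟ x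
  ... | yes refl with refl ← ++-cancelˡ p v y (sym (Canonical.split c))
    with m , ms , refl , g⊑m ← first-factor-⊒ g-sil g⊑y y-icfl
    = icfl-1 (¬xy-inv ∘ InvLyndon⇒InvLyndon′) (Canonical⇒CanonicalPair c) y-icfl
        (⊑⇒Prefix (⊑-trans (⊑-trans (⊑-++⁻ˡ p pq⊑xrb) rb⊑g) g⊑m))
  ... | no p≢x with ⊑-total (subst (p ⊑_) (sym (Canonical.split c)) (⊑-++ p v)) (⊑-++ x y)
  ...   | inj₂ x⊑p with z , refl ← ⊑⇒Prefix x⊑p =
    ⊥-elim (overshoot-impossible g-sil (≢++⇒≢[] x (p≢x ∘ sym)) (Canonical.q≢[] c)
      (Canonical.p⊏q c) (⊑-trans (⊑-trans (⊑-++ r [ a ]) ra⊑x) (⊑-++ x z))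
      rb⊑g (⊑-++⁻ˡ x (subst (_⊑ x ++ r ∷ʳ b) (++-assoc x z q) pq⊑xrb)))
  ...   | inj₁ p⊑x with x″ , refl ← ⊑⇒Prefix p⊑x with initLast q
  ...     | [] = ⊥-elim (Canonical.q≢[] c refl)
  ...     | r′ ∷ʳ′ b′
    with ⊑-∷ʳ r′ b′ (⊑-++⁻ˡ p (InvLyndon′⇒⊑shortest (Canonical.shortest c)
                                 (⊑-++ (p ++ x″) y) (InvLyndon⇒InvLyndon′ x-inv)))
  ...       | inj₂ refl =
    ⊥-elim (proj₁ (proj₂ (Canonical.shortest c)) (InvLyndon⇒InvLyndon′ x-inv))
  ...       | inj₁ x″⊑r′
    with refl ← ++-cancelˡ p v (x″ ++ y) (trans (sym (Canonical.split c)) (++-assoc p x″ y))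
    = icfl-2 (¬xy-inv ∘ InvLyndon⇒InvLyndon′) (Canonical⇒CanonicalPair c)
        (glue-InvLyndon g-sil g⊑y y-icfl x″ (rec (length-suffix< p x″ (Canonical.p≢[] c)))
          (InvLyndon′⇒InvLyndon (≢++⇒≢[] p p≢x)
            (InvLyndon′-⊑ (⊑-trans x″⊑r′ (⊑-++ r′ [ b′ ])) (Canonical.q-inv c)))
          (Suffixes⁺-suffix refl x-below))
        refl (⊑⇒Prefix x″⊑r′)

  glue : ∀ {g y ns x ms} → StrictlyInvLyndon g → g ⊑ y → IsICFL y ns →
         IsICFL x ms → Suffixes⁺ (_⊏ g) x → IsICFL (x ++ y) (ms ++ ns)
  glue g-sil g⊑y y-icfl (icfl-inv x-inv) x-below =
    glue-InvLyndon g-sil g⊑y y-icfl _ (<-wellFounded _) x-inv x-below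
  glue {y = y} g-sil g⊑y y-icfl x-icfl@(icfl-1 ¬inv pair v-icfl q≤ₚm) x-below =
    icfl-1 (¬InvLyndon-++ y (IsICFL⇒≢[] x-icfl) ¬inv) (CanonicalPair-++ y pair)
      (glue g-sil g⊑y y-icfl v-icfl (Suffixes⁺-suffix (proj₁ pair) x-below)) q≤ₚm
  glue {y = y} g-sil g⊑y y-icfl x-icfl@(icfl-2 ¬inv pair v-icfl q≡rb m≤ₚr) x-below =
    icfl-2 (¬InvLyndon-++ y (IsICFL⇒≢[] x-icfl) ¬inv) (CanonicalPair-++ y pair)
      (glue g-sil g⊑y y-icfl v-icfl (Suffixes⁺-suffix (proj₁ pair) x-below)) q≡rb m≤ₚr

  -- Non-increasing maximal chains for the prefix order

  ⪯in-⋣⇒⊏ : ∀ {t g : Word n} → g ⪯in t → ¬ Prefix g t → t ⊏ g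
  ⪯in-⋣⇒⊏ {g = g} (inj₂ refl) g⋢t = contradiction ([] , ++-identityʳ g) g⋢t
  ⪯in-⋣⇒⊏ (inj₁ g≺t) g⋢t with Lex-flip⇒⊏ g≺t
  ... | inj₁ (g≤ₚt , _) = contradiction g≤ₚt g⋢t
  ... | inj₂ t⊏g        = t⊏g

  -- Each factor of C extends the last one, t, and t ⊏ g by g ⪯in t and the boundary condition.
  PMC-⊏-next : ∀ {C g rest} → Linked (λ a b → Prefix b a) C → C ≢ [] →
               Linked (λ a b → b ⪯in a) (C ++ g ∷ rest) →
               (∀ t → last C ≡ just t → ¬ Prefix g t) → All (_⊏ g) C
  PMC-⊏-next {[]}    _ C≢[] _ _ = contradiction refl C≢[]
  PMC-⊏-next {x ∷ []} [-] _ (g⪯x ∷ _) boundary = ⪯in-⋣⇒⊏ g⪯x (boundary x refl) ∷ []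
  PMC-⊏-next {x ∷ y ∷ C} (y≤ₚx ∷ chain) _ (_ ∷ linked) boundary
    with y⊏g ∷ C⊏g ← PMC-⊏-next chain (λ ()) linked boundary =
    ⊏-⊑ˡ y⊏g (Prefix⇒⊑ y≤ₚx) ∷ y⊏g ∷ C⊏g

  PrefixChain⁺ : List (Word n) → Set
  PrefixChain⁺ C = (C ≢ []) × Linked (λ a b → Prefix b a) C

  glue-PMCs : ∀ {ws : List (Word n)} {Cs mss} →
              Pointwise IsCFLin ws Cs → Pointwise IsICFL ws mss →
              All PrefixChain⁺ Cs → Linked PMCBoundary Cs →
              Linked (λ a b → b ⪯in a) (concat Cs) → ws ≢ [] → IsICFL (concat ws) (concat mss)
  glue-PMCs [] [] _ _ _ ws≢[] = contradiction refl ws≢[]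
  glue-PMCs {w ∷ []} {_ ∷ []} {ms ∷ []} (_ ∷ []) (w-icfl ∷ []) _ _ _ _ =
    subst₂ IsICFL (sym (++-identityʳ w)) (sym (++-identityʳ ms)) w-icfl
  glue-PMCs {_ ∷ _ ∷ _} {_ ∷ [] ∷ _} (_ ∷ _ ∷ _) _ (_ ∷ (C≢[] , _) ∷ _) _ _ _ =
    contradiction refl C≢[]
  glue-PMCs {w₁ ∷ w₂ ∷ ws} {C₁ ∷ (g ∷ C₂) ∷ Cs}
    ((anti₁ , refl , _) ∷ cfls@((g-anti ∷ _ , refl , _) ∷ _)) (icfl₁ ∷ icfls)
    ((C₁≢[] , chain₁) ∷ chains) (boundary ∷ boundaries) linked _ =
    glue (AntiLyndon⇒StrictlyInvLyndon g-anti)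
      (⊑-trans (⊑-++ g (concat C₂)) (⊑-++ _ (concat ws)))
      (glue-PMCs cfls icfls chains boundaries (Linked-++⁻ʳ C₁ linked) (λ ()))
      icfl₁ (Suffixes⁺-concat (All.map AntiLyndon⇒StrictlyInvLyndon anti₁)
                              (PMC-⊏-next chain₁ C₁≢[] linked (λ t e → boundary t g e refl)))

  concat-PMC-words : ∀ {ws : List (Word n)} {Cs} → Pointwise IsCFLin ws Cs →
                     concat ws ≡ concat (concat Cs)
  concat-PMC-words [] = refl
  concat-PMC-words {Cs = C ∷ Cs} ((_ , refl , _) ∷ cfls) =
    trans (cong (concat C ++_) (concat-PMC-words cfls)) (concat-++ C (concat Cs))

  IsICFL-exists-pointwise : ∀ {ws : List (Word n)} {Cs} → Pointwise IsCFLin ws Cs →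
                            All PrefixChain⁺ Cs → ∃ (Pointwise IsICFL ws)
  IsICFL-exists-pointwise [] [] = [] , []
  IsICFL-exists-pointwise ((ℓ-anti ∷ _ , refl , _) ∷ cfls) (_ ∷ chains)
    with ms , ms-icfl ← IsICFL-exists _ (<-wellFounded _) (++-≢[]ˡ _ (proj₁ ℓ-anti))
    with mss , mss-icfl ← IsICFL-exists-pointwise cfls chains =
    ms ∷ mss , ms-icfl ∷ mss-icfl
  IsICFL-exists-pointwise (([] , _) ∷ _) ((C≢[] , _) ∷ _) = contradiction refl C≢[]

proposition9p2 : ∀ {n : ℕ} (w : Word n) → w ≢ [] →
    (ls : List (Word n)) → IsCFLin w ls →
    (Cs : List (List (Word n))) → IsPMCDecomp ls Cs →
    (ws : List (Word n)) → Pointwise IsCFLin ws Cs →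
    (Σ (List (List (Word n))) λ mss → Pointwise IsICFL ws mss × IsICFL w (concat mss))
    × (∀ (ms : List (Word n)) (mss : List (List (Word n))) →
         IsICFL w ms → Pointwise IsICFL ws mss → ms ≡ concat mss)
proposition9p2 w w≢[] ls (_ , concat-ls≡w , ls-linked) Cs (concat-Cs≡ls , chains , boundaries)
               ws ws-cfl
  with mss , ws-icfl ← IsICFL-exists-pointwise ws-cfl chains =
  (mss , ws-icfl , w-icfl ws-icfl) ,
  λ ms mss′ ms-icfl ws-icfl′ → IsICFL-functional ms-icfl (w-icfl ws-icfl′)
  where
  concat-ws≡w : concat ws ≡ w
  concat-ws≡w = trans (concat-PMC-words ws-cfl) (trans (cong concat concat-Cs≡ls) concat-ls≡w)
  w-icfl : ∀ {mss} → Pointwise IsICFL ws mss → IsICFL w (concat mss)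
  w-icfl ws-icfl = subst (λ u → IsICFL u _) concat-ws≡w
    (glue-PMCs ws-cfl ws-icfl chains boundaries (subst (Linked _) (sym concat-Cs≡ls) ls-linked)
      (w≢[] ∘ trans (sym concat-ws≡w) ∘ cong concat))
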